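{- Every single-cycle Belyi map $f: X \to \mathbb{P}^1$ (of any genus) admits a dessin d'enfant of diameter at most $4$.
   Context: A Belyi map is a finite morphism $f: X \to \mathbb{P}^1$ from a smooth projective curve $X$ that is ramified only over $0, 1, \infty$. It is a single-cycle Belyi map if it has exactly one ramification point above each of the three branch points $0,1,\infty$. A dessin d'enfant is a connected bipartite graph (black and white vertices) embedded in an orientable surface, with a cyclic ordering of the edges at each vertex; the dessin of $f$ has a black vertex for each point of $f^{ -1}(0)$ (of degree equal to the ramification index there), a white vertex for each point of $f^{ -1}(1)$ (likewise), and an edge for each component of $f^{ -1}((0,1))$. Here the diameter of a graph means the maximal number of vertices traversed in a path in the graph. -}

module Defs where

open import Data.Nat using (ℕ; zero; suc)
open import Data.Fin using (Fin)
open import Data.Fin.Permutation using (Permutation′; _⟨$⟩ʳ_; _⟨$⟩ˡ_; flip; _∘ₚ_)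
open import Data.Product using (Σ; ∃; _×_; _,_)
open import Relation.Binary.PropositionalEquality using (_≡_)
open import Relation.Nullary using (¬_)

-- Belyi maps of degree n correspond (Riemann existence) to permutation
-- triples (σ₀ , σ₁ , σ∞) on Fin n with σ₀ σ₁ σ∞ = 1 generating a transitive
-- group.  We encode them by (σ₀ , σ₁) and put σ∞ = (σ₀ ∘ₚ σ₁)⁻¹.

iter : ∀ {n} → Permutation′ n → ℕ → Fin n → Fin n
iter σ zero    x = x
iter σ (suc k) x = σ ⟨$⟩ʳ (iter σ k x)

SameCycle : ∀ {n} → Permutation′ n → Fin n → Fin n → Set
SameCycle σ x y = ∃ λ k → iter σ k x ≡ y

-- σ has exactly one cycle of length > 1 (exactly one ramification point)
SingleCycle : ∀ {n} → Permutation′ n → Set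
SingleCycle σ = ∃ λ x → ¬ (σ ⟨$⟩ʳ x ≡ x) ×
  (∀ y → ¬ (σ ⟨$⟩ʳ y ≡ y) → SameCycle σ x y)

data Reach {n} (σ₀ σ₁ : Permutation′ n) (x : Fin n) : Fin n → Set where
  here  : Reach σ₀ σ₁ x x
  step₀ : ∀ {y} → Reach σ₀ σ₁ x y → Reach σ₀ σ₁ x (σ₀ ⟨$⟩ʳ y)
  back₀ : ∀ {y} → Reach σ₀ σ₁ x y → Reach σ₀ σ₁ x (σ₀ ⟨$⟩ˡ y)
  step₁ : ∀ {y} → Reach σ₀ σ₁ x y → Reach σ₀ σ₁ x (σ₁ ⟨$⟩ʳ y)
  back₁ : ∀ {y} → Reach σ₀ σ₁ x y → Reach σ₀ σ₁ x (σ₁ ⟨$⟩ˡ y)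

Transitive : ∀ {n} → Permutation′ n → Permutation′ n → Set
Transitive σ₀ σ₁ = ∀ x y → Reach σ₀ σ₁ x y

σ∞ : ∀ {n} → Permutation′ n → Permutation′ n → Permutation′ n
σ∞ σ₀ σ₁ = flip (σ₀ ∘ₚ σ₁)

record SingleCycleBelyi (n : ℕ) : Set where
  field
    σ₀ σ₁ : Permutation′ n
    transitive : Transitive σ₀ σ₁
    single₀ : SingleCycle σ₀
    single₁ : SingleCycle σ₁
    single∞ : SingleCycle (σ∞ σ₀ σ₁)

-- The dessin: black vertices = cycles of σ₀, white vertices = cycles of σ₁,
-- edges = Fin n, edge e joins the σ₀-cycle and the σ₁-cycle containing e.
-- A vertex is named by a colour and a representative point.
data Colour : Set where
  black white : Colour

Vertex : ℕ → Set
Vertex n = Colour × Fin n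

module Dessin {n} (σ₀ σ₁ : Permutation′ n) where
  perm : Colour → Permutation′ n
  perm black = σ₀
  perm white = σ₁

  SameVertex : Vertex n → Vertex n → Set
  SameVertex (c , x) (d , y) = (c ≡ d) × SameCycle (perm c) x y

  Incident : Fin n → Vertex n → Set
  Incident e (c , x) = SameCycle (perm c) x e

  Adjacent : Vertex n → Vertex n → Set
  Adjacent (c , x) (d , y) = ¬ (c ≡ d) × ∃ λ e → Incident e (c , x) × Incident e (d , y)

  record Path (m : ℕ) : Set where
    field
      vert : Fin m → Vertex n
      adj : ∀ (i : Fin m) (j : Fin m) → Data.Fin.toℕ j ≡ suc (Data.Fin.toℕ i) →
            Adjacent (vert i) (vert j)
      distinct : ∀ i j → SameVertex (vert i) (vert j) → i ≡ j

  -- diameter ≤ d : every path traverses at most d vertices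
  DiameterAtMost : ℕ → Set
  DiameterAtMost d = ∀ m → Path m → m Data.Nat.≤ d

{-# OPTIONS --safe #-}
module Submission where

open import Defs
open import Data.Nat using (ℕ; zero; suc; _+_; _*_; _≤_; _≤?_)
open import Data.Nat.Properties using (+-comm; +-suc; *-suc; n<1+n; ≰⇒>; m≤n⇒∃[o]m+o≡n)
open import Data.Fin using (Fin; toℕ; inject≤)
open import Data.Fin.Patterns using (0F; 1F; 2F; 3F; 4F)
open import Data.Fin.Properties using (pigeonhole; _≟_; toℕ-inject≤; inject≤-injective)
open import Data.Fin.Permutation using (Permutation′; _⟨$⟩ʳ_; _⟨$⟩ˡ_; inverseˡ)
open import Data.Product using (∃; _×_; _,_)
open import Data.Sum using (_⊎_; inj₁; inj₂)
open import Data.Empty using (⊥; ⊥-elim)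
open import Function using (_∘_)
open import Relation.Nullary using (¬_; Dec; yes; no)
open import Relation.Binary.PropositionalEquality

-- A vertex of the dessin is either a leaf (a fixed point of its
-- permutation) or the unique non-leaf vertex of its colour.  Two leaves are
-- never adjacent, for their common edge would be fixed by σ₀ and σ₁ and hence,
-- by transitivity, be the whole dessin, while σ₀ is not the identity.  So in a
-- path v₀ v₁ v₂ v₃ v₄ either v₁ is a leaf and v₀, v₂ are the non-leaf vertex
-- of their colour, or likewise v₃ is a leaf and v₂ = v₄, or v₁ = v₃.

Fixed : ∀ {n} → Permutation′ n → Fin n → Set
Fixed σ x = σ ⟨$⟩ʳ x ≡ x

module _ {n : ℕ} (σ : Permutation′ n) where

  iter-+ : ∀ a b x → iter σ (a + b) x ≡ iter σ a (iter σ b x)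
  iter-+ zero    b x = refl
  iter-+ (suc a) b x = cong (σ ⟨$⟩ʳ_) (iter-+ a b x)

  iter-injective : ∀ k {x y} → iter σ k x ≡ iter σ k y → x ≡ y
  iter-injective zero    eq = eq
  iter-injective (suc k) {x} {y} eq = iter-injective k (begin
    iter σ k x                          ≡⟨ inverseˡ σ ⟨
    σ ⟨$⟩ˡ (σ ⟨$⟩ʳ iter σ k x)          ≡⟨ cong (σ ⟨$⟩ˡ_) eq ⟩
    σ ⟨$⟩ˡ (σ ⟨$⟩ʳ iter σ k y)          ≡⟨ inverseˡ σ ⟩
    iter σ k y                          ∎)
    where open ≡-Reasoning

  iter-period : ∀ x → ∃ λ d → iter σ (suc d) x ≡ x
  iter-period x with pigeonhole (n<1+n n) (λ i → iter σ (toℕ i) x)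
  ... | i , j , i<j , eq with m≤n⇒∃[o]m+o≡n i<j
  ... | o , i+1+o≡j = o , iter-injective (toℕ i) (begin
    iter σ (toℕ i) (iter σ (suc o) x)   ≡⟨ iter-+ (toℕ i) (suc o) x ⟨
    iter σ (toℕ i + suc o) x            ≡⟨ cong (λ t → iter σ t x) (trans (+-suc (toℕ i) o) i+1+o≡j) ⟩
    iter σ (toℕ j) x                    ≡⟨ eq ⟨
    iter σ (toℕ i) x                    ∎)
    where open ≡-Reasoning

  iter-*-period : ∀ p {x} → iter σ p x ≡ x → ∀ k → iter σ (k * p) x ≡ x
  iter-*-period p eq zero    = refl
  iter-*-period p {x} eq (suc k) = begin
    iter σ (p + k * p) x                ≡⟨ iter-+ p (k * p) x ⟩
    iter σ p (iter σ (k * p) x)         ≡⟨ cong (iter σ p) (iter-*-period p eq k) ⟩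
    iter σ p x                          ≡⟨ eq ⟩
    x                                   ∎
    where open ≡-Reasoning

  iter-fixed : ∀ {x} → Fixed σ x → ∀ k → iter σ k x ≡ x
  iter-fixed fx zero    = refl
  iter-fixed fx (suc k) = trans (cong (σ ⟨$⟩ʳ_) (iter-fixed fx k)) fx

  inverse-fixed : ∀ {x} → Fixed σ x → σ ⟨$⟩ˡ x ≡ x
  inverse-fixed fx = trans (cong (σ ⟨$⟩ˡ_) (sym fx)) (inverseˡ σ)

  SameCycle-sym : ∀ {x y} → SameCycle σ x y → SameCycle σ y x
  SameCycle-sym {x} (k , refl) with iter-period x
  ... | d , period = k * d , (begin
    iter σ (k * d) (iter σ k x)         ≡⟨ iter-+ (k * d) k x ⟨
    iter σ (k * d + k) x                ≡⟨ cong (λ t → iter σ t x) (trans (*-suc k d) (+-comm k (k * d))) ⟨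
    iter σ (k * suc d) x                ≡⟨ iter-*-period (suc d) period k ⟩
    x                                   ∎)
    where open ≡-Reasoning

  SameCycle-trans : ∀ {x y z} → SameCycle σ x y → SameCycle σ y z → SameCycle σ x z
  SameCycle-trans {x} (k , refl) (l , refl) = l + k , iter-+ l k x

  SingleCycle⇒moves : SingleCycle σ → ∃ (¬_ ∘ Fixed σ)
  SingleCycle⇒moves (x , mx , _) = x , mx

  SingleCycle⇒SameCycle : SingleCycle σ → ∀ {x y} → ¬ Fixed σ x → ¬ Fixed σ y → SameCycle σ x y
  SingleCycle⇒SameCycle (_ , _ , inCycle) mx my = SameCycle-trans (SameCycle-sym (inCycle _ mx)) (inCycle _ my)

module _ {n : ℕ} {σ₀ σ₁ : Permutation′ n} where

  Reach-from-common-fixed : ∀ {x y} → Fixed σ₀ x → Fixed σ₁ x → Reach σ₀ σ₁ x y → y ≡ x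
  Reach-from-common-fixed f₀ f₁ here = refl
  Reach-from-common-fixed f₀ f₁ (step₀ r) rewrite Reach-from-common-fixed f₀ f₁ r = f₀
  Reach-from-common-fixed f₀ f₁ (back₀ r) rewrite Reach-from-common-fixed f₀ f₁ r = inverse-fixed σ₀ f₀
  Reach-from-common-fixed f₀ f₁ (step₁ r) rewrite Reach-from-common-fixed f₀ f₁ r = f₁
  Reach-from-common-fixed f₀ f₁ (back₁ r) rewrite Reach-from-common-fixed f₀ f₁ r = inverse-fixed σ₁ f₁

  Transitive⇒¬common-fixed : Transitive σ₀ σ₁ → ∃ (¬_ ∘ Fixed σ₀) →
                             ∀ {x} → ¬ (Fixed σ₀ x × Fixed σ₁ x)
  Transitive⇒¬common-fixed transitive (z , mz) {x} (f₀ , f₁) = mz (begin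
    σ₀ ⟨$⟩ʳ z                           ≡⟨ Reach-from-common-fixed f₀ f₁ (transitive x (σ₀ ⟨$⟩ʳ z)) ⟩
    x                                   ≡⟨ Reach-from-common-fixed f₀ f₁ (transitive x z) ⟨
    z                                   ∎)
    where open ≡-Reasoning

≢-≢⇒≡ : ∀ {a b c : Colour} → ¬ a ≡ b → ¬ b ≡ c → a ≡ c
≢-≢⇒≡ {black} {white} {black} _ _ = refl
≢-≢⇒≡ {white} {black} {white} _ _ = refl
≢-≢⇒≡ {black} {black}         a≢b _ = ⊥-elim (a≢b refl)
≢-≢⇒≡ {white} {white}         a≢b _ = ⊥-elim (a≢b refl)
≢-≢⇒≡ {_}     {black} {black} _ b≢c = ⊥-elim (b≢c refl)
≢-≢⇒≡ {_}     {white} {white} _ b≢c = ⊥-elim (b≢c refl)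

module _ {n : ℕ} (σ₀ σ₁ : Permutation′ n) where
  open Dessin σ₀ σ₁

  Leaf : Vertex n → Set
  Leaf (c , x) = Fixed (perm c) x

  leaf? : ∀ v → Dec (Leaf v)
  leaf? (c , x) = perm c ⟨$⟩ʳ x ≟ x

  leaf-edge-fixed : ∀ {c x e} → Leaf (c , x) → Incident e (c , x) → Fixed (perm c) e
  leaf-edge-fixed {c} fx (k , refl) rewrite iter-fixed (perm c) fx k = fx

  fixed-by-both : ∀ {c d e} → ¬ c ≡ d → Fixed (perm c) e → Fixed (perm d) e → Fixed σ₀ e × Fixed σ₁ e
  fixed-by-both {black} {white} _ f f′ = f , f′
  fixed-by-both {white} {black} _ f f′ = f′ , f
  fixed-by-both {black} {black} c≢d _ _ = ⊥-elim (c≢d refl)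
  fixed-by-both {white} {white} c≢d _ _ = ⊥-elim (c≢d refl)

  Adjacent-Adjacent⇒same-colour : ∀ {c x d y e z} → Adjacent (c , x) (d , y) → Adjacent (d , y) (e , z) → c ≡ e
  Adjacent-Adjacent⇒same-colour (c≢d , _) (d≢e , _) = ≢-≢⇒≡ c≢d d≢e

  Path-take : ∀ {m m′} → m ≤ m′ → Path m′ → Path m
  Path-take m≤m′ P = record
    { vert     = vert ∘ inj
    ; adj      = λ i j j≡1+i → adj (inj i) (inj j)
                   (trans (toℕ-inject≤ j m≤m′) (trans j≡1+i (cong suc (sym (toℕ-inject≤ i m≤m′)))))
    ; distinct = λ i j same → inject≤-injective m≤m′ m≤m′ i j (distinct (inj i) (inj j) same)
    }
    where
    open Path P
    inj = λ i → inject≤ i m≤m′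

module _ {n : ℕ} (f : SingleCycleBelyi n) where
  open SingleCycleBelyi f
  open Dessin σ₀ σ₁
  open Path using (adj; distinct)

  ¬Adjacent-leaves : ∀ {v w} → Adjacent v w → Leaf σ₀ σ₁ v → Leaf σ₀ σ₁ w → ⊥
  ¬Adjacent-leaves (c≢d , e , v∋e , w∋e) lv lw =
    Transitive⇒¬common-fixed transitive (SingleCycle⇒moves σ₀ single₀)
      (fixed-by-both σ₀ σ₁ c≢d (leaf-edge-fixed σ₀ σ₁ lv v∋e) (leaf-edge-fixed σ₀ σ₁ lw w∋e))

  single : ∀ c → SingleCycle (perm c)
  single black = single₀
  single white = single₁

  nonLeaf-unique : ∀ {c x d y} → c ≡ d →
                   ¬ Leaf σ₀ σ₁ (c , x) → ¬ Leaf σ₀ σ₁ (d , y) → SameVertex (c , x) (d , y)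
  nonLeaf-unique {c} refl mx my = refl , SingleCycle⇒SameCycle (perm c) (single c) mx my

  leaf-neighbours-same : ∀ {u v w} → Adjacent u v → Adjacent v w → Leaf σ₀ σ₁ v → SameVertex u w
  leaf-neighbours-same uv vw lv =
    nonLeaf-unique (Adjacent-Adjacent⇒same-colour σ₀ σ₁ uv vw)
      (λ lu → ¬Adjacent-leaves uv lu lv) (λ lw → ¬Adjacent-leaves vw lv lw)

  five-walk-repeats : ∀ {v₀ v₁ v₂ v₃ v₄} →
    Adjacent v₀ v₁ → Adjacent v₁ v₂ → Adjacent v₂ v₃ → Adjacent v₃ v₄ →
    SameVertex v₀ v₂ ⊎ SameVertex v₁ v₃ ⊎ SameVertex v₂ v₄
  five-walk-repeats {v₁ = v₁} {v₃ = v₃} a₀₁ a₁₂ a₂₃ a₃₄ with leaf? σ₀ σ₁ v₁ | leaf? σ₀ σ₁ v₃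
  ... | yes l₁ | _      = inj₁ (leaf-neighbours-same a₀₁ a₁₂ l₁)
  ... | no _   | yes l₃ = inj₂ (inj₂ (leaf-neighbours-same a₂₃ a₃₄ l₃))
  ... | no m₁  | no m₃  = inj₂ (inj₁ (nonLeaf-unique (Adjacent-Adjacent⇒same-colour σ₀ σ₁ a₁₂ a₂₃) m₁ m₃))

  ¬Path5 : ¬ Path 5
  ¬Path5 P with five-walk-repeats (adj P 0F 1F refl) (adj P 1F 2F refl) (adj P 2F 3F refl) (adj P 3F 4F refl)
  ... | inj₁ s        with () ← distinct P 0F 2F s
  ... | inj₂ (inj₁ s) with () ← distinct P 1F 3F s
  ... | inj₂ (inj₂ s) with () ← distinct P 2F 4F s

proposition2p2 : (n : ℕ) (f : SingleCycleBelyi n) →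
    Dessin.DiameterAtMost (SingleCycleBelyi.σ₀ f) (SingleCycleBelyi.σ₁ f) 4
proposition2p2 n f m P with m ≤? 4
... | yes m≤4 = m≤4
... | no m≰4  = ⊥-elim (¬Path5 f (Path-take _ _ (≰⇒> m≰4) P))
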